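{- For integers $n\ge k\ge2$, let \[ \mathfrak{S}_1(n,k)=S^2(n,k-1)-S(n,k-2)S(n,k). \] Then for any fixed integers $n\ge k\ge 2$, the infinite sequence $\{\mathfrak{S}_1(n+m,k+m)\}_{m\ge0}$ is strictly increasing in $m$.
   Context: $S(n,k)$ denotes the Stirling number of the second kind, i.e. the number of ways to partition an $n$-element set into $k$ nonempty subsets; equivalently $S(n,k)=\frac1{k!}\sum_{i=0}^k(-1)^i\binom{k}{i}(k-i)^n$. In particular $S(0,0)=1$ and $S(n,0)=0$ for $n\ge1$. $S^2(n,k)$ means $(S(n,k))^2$. -}

module Defs where

open import Data.Nat using (ℕ; zero; suc; _∸_)
import Data.Nat as ℕ
open import Data.Integer using (ℤ; +_; _-_; _*_)

S : ℕ → ℕ → ℕ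
S zero    zero    = 1
S zero    (suc k) = 0
S (suc n) zero    = 0
S (suc n) (suc k) = suc k ℕ.* S n (suc k) ℕ.+ S n k

𝔖₁ : ℕ → ℕ → ℤ
𝔖₁ n k = (+ S n (k ∸ 1)) * (+ S n (k ∸ 1)) - (+ S n (k ∸ 2)) * (+ S n k)

module Submission where

-- Write A, B, C, D for S(N,c), …, S(N,c+3).  Expanding the three Stirling
-- numbers S(N+1,c+1), S(N+1,c+2), S(N+1,c+3) by the recurrence gives the
-- integer identity
--   𝔖₁(N+1,c+3) = 𝔖₁(N,c+2) + (c+1)(c+3)·𝔖₁(N,c+3) + (c+3)·(BC - AD) + C².
-- If every row of Stirling numbers is log-concave (𝔖₁ ≥ 0), then also
-- BC ≥ AD (a log-concave sequence without internal zeros satisfies this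
-- "crossing" inequality), so the increment is ≥ C², and C > 0 once c+2 ≤ N.
-- Log-concavity of the rows is itself proved by induction on N from the
-- same identity, the increment being ≥ 0 without any positivity assumption.

open import Defs
open import Data.Nat using (ℕ; _≤_; _+_)
open import Data.Integer using (_<_)
open import Data.Nat using (zero; suc; z≤n; s≤s; _*_; _≤?_)
import Data.Nat as ℕ
open import Data.Nat.Properties
  using (≤-trans; m≤n⇒m≤1+n; ≰⇒>; m≤n+m; *-zeroʳ; *-mono-≤; *-cancelʳ-≤; +-suc; +-monoˡ-≤; module ≤-Reasoning)
open import Data.Integer as ℤ using (ℤ; +_; +≤+; +<+; 0ℤ; _-_)
open import Data.Integer.Properties as ℤP using (pos-*; pos-+)
open import Data.Integer.Tactic.RingSolver using (solve-∀)
open import Data.Nat.Tactic.RingSolver using () renaming (solve-∀ to solveℕ-∀)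
open import Relation.Binary.PropositionalEquality
open import Relation.Nullary using (yes; no)

S-vanishes : ∀ n k → n ℕ.< k → S n k ≡ 0
S-vanishes zero    (suc k) _ = refl
S-vanishes (suc n) (suc k) (s≤s n<k)
  rewrite S-vanishes n (suc k) (m≤n⇒m≤1+n n<k) | S-vanishes n k n<k | *-zeroʳ k = refl

S-one : ∀ n → S (suc n) 1 ≡ 1
S-one zero    = refl
S-one (suc n) rewrite S-one n = refl

-- S(n,k) > 0 when 1 ≤ k ≤ n, since S(n+1,k+1) ≥ S(n,k) reduces it to S(n-k+1,1) = 1.
S-positive : ∀ n k → k ≤ n → 0 ℕ.< S (suc n) (suc k)
S-positive n       zero    _         = subst (0 ℕ.<_) (sym (S-one n)) (s≤s z≤n)
S-positive (suc n) (suc k) (s≤s k≤n) =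
  ≤-trans (S-positive n k k≤n) (m≤n+m (S (suc n) (suc k)) (suc (suc k) * S (suc n) (suc (suc k))))

-- Crossing inequality: if x₀,x₁,x₂,x₃ is log-concave and x₁x₂ > 0, then
-- x₀x₃ ≤ x₁x₂.  Multiply the two log-concavity inequalities and cancel x₁x₂.
log-concave⇒crossing : ∀ x₀ x₁ x₂ x₃ → x₀ * x₂ ≤ x₁ * x₁ → x₁ * x₃ ≤ x₂ * x₂ →
                       0 ℕ.< x₁ * x₂ → x₀ * x₃ ≤ x₁ * x₂
log-concave⇒crossing x₀ x₁ x₂ x₃ lc₀ lc₁ pos =
  *-cancelʳ-≤ (x₀ * x₃) (x₁ * x₂) (x₁ * x₂) {{ℕ.>-nonZero pos}} product-bound
  where
  open ≤-Reasoning
  product-bound : x₀ * x₃ * (x₁ * x₂) ≤ x₁ * x₂ * (x₁ * x₂)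
  product-bound = begin
    x₀ * x₃ * (x₁ * x₂)   ≡⟨ regroup x₀ x₃ x₁ x₂ ⟩
    x₀ * x₂ * (x₁ * x₃)   ≤⟨ *-mono-≤ lc₀ lc₁ ⟩
    x₁ * x₁ * (x₂ * x₂)   ≡⟨ interchange x₁ x₁ x₂ x₂ ⟩
    x₁ * x₂ * (x₁ * x₂)   ∎
    where
    regroup : ∀ a b c d → a * b * (c * d) ≡ a * d * (c * b)
    regroup = solveℕ-∀
    interchange : ∀ a b c d → a * b * (c * d) ≡ a * c * (b * d)
    interchange = solveℕ-∀

LogConcave : ℕ → Set
LogConcave N = ∀ j → S N j * S N (2 + j) ≤ S N (1 + j) * S N (1 + j)

-- A log-concave row satisfies S(N,i) S(N,i+3) ≤ S(N,i+1) S(N,i+2): either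
-- S(N,i+3) = 0, or i+2 ≤ N and the middle entries are positive.
crossing : ∀ N → LogConcave N → ∀ i → S N i * S N (3 + i) ≤ S N (1 + i) * S N (2 + i)
crossing N lc i with 2 + i ≤? N
... | no  N≱2+i rewrite S-vanishes N (3 + i) (m≤n⇒m≤1+n (≰⇒> N≱2+i)) | *-zeroʳ (S N i) = z≤n
crossing (suc N) lc i | yes (s≤s 1+i≤N) =
  log-concave⇒crossing (S (suc N) i) (S (suc N) (1 + i)) (S (suc N) (2 + i)) (S (suc N) (3 + i))
    (lc i) (lc (1 + i))
    (*-mono-≤ (S-positive N i (≤-trans (m≤n+m i 1) 1+i≤N)) (S-positive N (1 + i) 1+i≤N))

≤⇒nonneg-det : ∀ a b c d → c * d ≤ a * b → 0ℤ ℤ.≤ + a ℤ.* + b - + c ℤ.* + d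
≤⇒nonneg-det a b c d cd≤ab =
  subst₂ (λ x y → 0ℤ ℤ.≤ x - y) (pos-* a b) (pos-* c d) (ℤP.i≤j⇒0≤j-i (+≤+ cd≤ab))

nonneg-det⇒≤ : ∀ a b c d → 0ℤ ℤ.≤ + a ℤ.* + b - + c ℤ.* + d → c * d ≤ a * b
nonneg-det⇒≤ a b c d 0≤det = ℤP.drop‿+≤+
  (ℤP.0≤i-j⇒j≤i (subst₂ (λ x y → 0ℤ ℤ.≤ x - y) (sym (pos-* a b)) (sym (pos-* c d)) 0≤det))

nonneg-scale : ∀ k {i} → 0ℤ ℤ.≤ i → 0ℤ ℤ.≤ + k ℤ.* i
nonneg-scale k {+ a} (+≤+ _) = subst (0ℤ ℤ.≤_) (pos-* k a) (+≤+ z≤n)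

nonneg-+ : ∀ {i j} → 0ℤ ℤ.≤ i → 0ℤ ℤ.≤ j → 0ℤ ℤ.≤ i ℤ.+ j
nonneg-+ = ℤP.+-mono-≤

nonneg-+-pos : ∀ {i j} → 0ℤ ℤ.≤ i → 0ℤ ℤ.< j → 0ℤ ℤ.< i ℤ.+ j
nonneg-+-pos = ℤP.+-mono-≤-<

<-+-pos : ∀ i {j} → 0ℤ ℤ.< j → i ℤ.< i ℤ.+ j
<-+-pos i 0<j = subst (ℤ._< i ℤ.+ _) (ℤP.+-identityʳ i) (ℤP.+-monoʳ-< i 0<j)

𝔗 : ℕ → ℕ → ℤ
𝔗 N i = + S N (1 + i) ℤ.* + S N (2 + i) - + S N i ℤ.* + S N (3 + i)

-- The part of 𝔖₁(N+1,c+3) - 𝔖₁(N,c+2) that is nonnegative on log-concave rows.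
coupling : ℕ → ℕ → ℤ
coupling N c = + ((1 + c) * (3 + c)) ℤ.* 𝔖₁ N (3 + c) ℤ.+ + (3 + c) ℤ.* 𝔗 N c

𝔖₁-recurrence : ∀ N c →
  𝔖₁ (suc N) (3 + c) ≡ 𝔖₁ N (2 + c) ℤ.+ (coupling N c ℤ.+ + S N (2 + c) ℤ.* + S N (2 + c))
𝔖₁-recurrence N c = trans expand-recurrence (expansion (+ (1 + c)) (+ A) (+ B) (+ C) (+ D))
  where
  A = S N c
  B = S N (1 + c)
  C = S N (2 + c)
  D = S N (3 + c)

  pos-linear : ∀ k x y → + (k * x + y) ≡ + k ℤ.* + x ℤ.+ + y
  pos-linear k x y = trans (pos-+ (k * x) y) (cong (ℤ._+ + y) (pos-* k x))

  expand-recurrence : 𝔖₁ (suc N) (3 + c)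
    ≡ (+ (2 + c) ℤ.* + C ℤ.+ + B) ℤ.* (+ (2 + c) ℤ.* + C ℤ.+ + B)
      - (+ (1 + c) ℤ.* + B ℤ.+ + A) ℤ.* (+ (3 + c) ℤ.* + D ℤ.+ + C)
  expand-recurrence = cong₂ (λ x yz → x ℤ.* x - yz) (pos-linear (2 + c) C B)
                            (cong₂ ℤ._*_ (pos-linear (1 + c) B A) (pos-linear (3 + c) D C))

  -- The polynomial identity behind the recurrence, with k standing for c+1.
  expansion : ∀ (k a b c d : ℤ) →
    ((+ 1 ℤ.+ k) ℤ.* c ℤ.+ b) ℤ.* ((+ 1 ℤ.+ k) ℤ.* c ℤ.+ b) - (k ℤ.* b ℤ.+ a) ℤ.* ((+ 2 ℤ.+ k) ℤ.* d ℤ.+ c)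
    ≡ (b ℤ.* b - a ℤ.* c)
      ℤ.+ ((k ℤ.* (+ 2 ℤ.+ k)) ℤ.* (c ℤ.* c - b ℤ.* d) ℤ.+ (+ 2 ℤ.+ k) ℤ.* (b ℤ.* c - a ℤ.* d)
           ℤ.+ c ℤ.* c)
  expansion = solve-∀

𝔖₁-nonneg : ∀ N → LogConcave N → ∀ j → 0ℤ ℤ.≤ 𝔖₁ N (2 + j)
𝔖₁-nonneg N lc j = ≤⇒nonneg-det (S N (1 + j)) (S N (1 + j)) (S N j) (S N (2 + j)) (lc j)

coupling-nonneg : ∀ N → LogConcave N → ∀ c → 0ℤ ℤ.≤ coupling N c
coupling-nonneg N lc c = nonneg-+
  (nonneg-scale ((1 + c) * (3 + c)) (𝔖₁-nonneg N lc (1 + c)))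
  (nonneg-scale (3 + c) (≤⇒nonneg-det (S N (1 + c)) (S N (2 + c)) (S N c) (S N (3 + c)) (crossing N lc c)))

log-concave : ∀ N → LogConcave N
log-concave zero    j rewrite *-zeroʳ (S zero j) = z≤n
log-concave (suc N) zero    = z≤n
log-concave (suc N) (suc c) =
  nonneg-det⇒≤ (S (suc N) (2 + c)) (S (suc N) (2 + c)) (S (suc N) (1 + c)) (S (suc N) (3 + c))
    (subst (0ℤ ℤ.≤_) (sym (𝔖₁-recurrence N c))
      (nonneg-+ (𝔖₁-nonneg N (log-concave N) c)
                (nonneg-+ (coupling-nonneg N (log-concave N) c) (nonneg-scale (S N (2 + c)) (+≤+ z≤n)))))

-- One diagonal step strictly increases 𝔖₁ once c+2 ≤ N: the increment is
-- the nonnegative coupling plus S(N,c+2)², and S(N,c+2) > 0.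
𝔖₁-diagonal-step : ∀ N c → 2 + c ≤ N → 𝔖₁ N (2 + c) ℤ.< 𝔖₁ (suc N) (3 + c)
𝔖₁-diagonal-step (suc N) c (s≤s 1+c≤N) =
  subst (𝔖₁ (suc N) (2 + c) ℤ.<_) (sym (𝔖₁-recurrence (suc N) c))
    (<-+-pos (𝔖₁ (suc N) (2 + c)) (nonneg-+-pos (coupling-nonneg (suc N) (log-concave (suc N)) c) C²-positive))
  where
  C = S (suc N) (2 + c)
  C²-positive : 0ℤ ℤ.< + C ℤ.* + C
  C²-positive = subst (0ℤ ℤ.<_) (pos-* C C)
    (+<+ (*-mono-≤ (S-positive N (1 + c) 1+c≤N) (S-positive N (1 + c) 1+c≤N)))

-- Theorem 4.1: the step from m to m+1 is the diagonal step at N = n+m,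
-- c = k-2+m, and c+2 = k+m ≤ n+m.
theorem4p1 : (n k : ℕ) → 2 ≤ k → k ≤ n →
    (m : ℕ) → 𝔖₁ (n + m) (k + m) < 𝔖₁ (n + (1 + m)) (k + (1 + m))
theorem4p1 n (suc (suc c)) (s≤s (s≤s z≤n)) k≤n m rewrite +-suc n m | +-suc c m =
  𝔖₁-diagonal-step (n + m) (c + m) (+-monoˡ-≤ m k≤n)
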